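{- Let $d\ge2$, $\mathbb{F}$ a field and $0\neq q\in\mathbb{F}$. Define the upper triangular $T\in{\rm Mat}_{d+1}(\mathbb{F})$ by $T_{ij}={j\brack i}_q$ for $0\le i\le j\le d$ and $T_{ij}=0$ for $i>j$. Then for $0\le i\le j\le d$, $\det(T[i,j])=q^{i(j-i)(j-i+1)/2}$.
   Context: Matrices are indexed by $0,\dots,d$; $T[i,j]$ is the submatrix with rows $0,\dots,j-i$ and columns $i,\dots,j$. The $q$-binomial coefficient ${n\brack k}_q$ ($0\le k\le n$) is the Gaussian binomial coefficient $\frac{[n]_q^!}{[k]_q^![n-k]_q^!}$, with $[m]_q=\sum_{i=0}^{m-1}q^i$, $[m]_q^!=\prod_{i=1}^m[i]_q$; it is a polynomial in $q$ with integer coefficients, evaluated at $q\in\mathbb{F}$. -}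

module Defs where

open import Level using (Level; _⊔_) renaming (suc to lsuc)
open import Algebra.Bundles using (CommutativeRing)
open import Data.Nat as ℕ using (ℕ; zero; suc; _∸_; _≤_; _<_; s≤s; z≤n)
open import Data.Nat.Properties as ℕP using (m+[n∸m]≡n; ≤-trans; +-monoʳ-≤)
open import Data.Fin as Fin using (Fin; toℕ; punchIn; fromℕ<; inject≤)
open import Data.Fin.Properties using (toℕ≤pred[n])
open import Data.Product using (∃)
open import Relation.Nullary using (¬_)
open import Relation.Binary.PropositionalEquality using (subst) renaming (sym to ≡-sym)

record Field (c ℓ : Level) : Set (lsuc (c ⊔ ℓ)) where
  field
    commutativeRing : CommutativeRing c ℓ
  open CommutativeRing commutativeRing public
  field
    0≉1     : ¬ (0# ≈ 1#)
    inverse : ∀ x → ¬ (x ≈ 0#) → ∃ λ y → x * y ≈ 1#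

module MatDefs {c ℓ : Level} (R : CommutativeRing c ℓ) where
  open CommutativeRing R

  Mat : ℕ → Set c
  Mat n = Fin n → Fin n → Carrier

  pow : Carrier → ℕ → Carrier
  pow x zero    = 1#
  pow x (suc n) = x * pow x n

  sign : ℕ → Carrier
  sign zero    = 1#
  sign (suc k) = - sign k

  sumFin : ∀ n → (Fin n → Carrier) → Carrier
  sumFin zero    f = 0#
  sumFin (suc n) f = f Fin.zero + sumFin n (λ k → f (Fin.suc k))

  det : ∀ n → Mat n → Carrier
  det zero    M = 1#
  det (suc n) M =
    sumFin (suc n) (λ j → sign (toℕ j) * (M Fin.zero j *
      det n (λ r s → M (Fin.suc r) (punchIn j s))))

  qint : Carrier → ℕ → Carrier
  qint q zero    = 0#
  qint q (suc m) = pow q m + qint q m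

  -- Gaussian binomial coefficient [n choose k]_q, evaluated at q, given by
  -- the q-Pascal recurrence (an identity of integer polynomials):
  --   [0 choose 0] = 1, [0 choose k+1] = 0,
  --   [n+1 choose 0] = 1, [n+1 choose k+1] = [n choose k] + q^(k+1) [n choose k+1].
  qbinom : Carrier → ℕ → ℕ → Carrier
  qbinom q zero    zero    = 1#
  qbinom q zero    (suc k) = 0#
  qbinom q (suc n) zero    = 1#
  qbinom q (suc n) (suc k) = qbinom q n k + pow q (suc k) * qbinom q n (suc k)

  Tmat : ∀ d → Carrier → Mat (suc d)
  Tmat d q i j with toℕ i ℕ.≤? toℕ j
  ... | Relation.Nullary.yes _ = qbinom q (toℕ j) (toℕ i)
  ... | Relation.Nullary.no  _ = 0#

  private
    colBound : ∀ {d i j} → i ≤ j → j ≤ d → (s : Fin (suc (j ∸ i))) → i ℕ.+ toℕ s < suc d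
    colBound {d} {i} {j} i≤j j≤d s =
      s≤s (≤-trans (+-monoʳ-≤ i (toℕ≤pred[n] s))
                   (subst (_≤ d) (≡-sym (m+[n∸m]≡n i≤j)) j≤d))

    rowBound : ∀ {d i j} → j ≤ d → suc (j ∸ i) ≤ suc d
    rowBound {d} {i} {j} j≤d = s≤s (≤-trans (ℕP.m∸n≤m j i) j≤d)

  -- T[i,j]: the submatrix with rows 0,…,j-i and columns i,…,j (size j-i+1).
  sub : ∀ d → Mat (suc d) → (i j : ℕ) → i ≤ j → j ≤ d → Mat (suc (j ∸ i))
  sub d M i j i≤j j≤d r s =
    M (inject≤ r (rowBound {d} {i} {j} j≤d))
      (fromℕ< (colBound {d} {i} {j} i≤j j≤d s))

{-# OPTIONS --safe #-}
module Submission where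

-- T[i,j] is the case c = 0, n = j - i of the matrix  weighted c i n  whose entry in row r and
-- column s is q^(c(m ∸ r)) [m choose r]_q with m = i + s. By the dual q-Pascal rule
-- [m+1 choose r+1] = q^(m-r) [m choose r] + [m choose r+1], subtracting q^c times each column
-- from the next one clears the first row except for its entry q^(ci), and leaves  weighted (c+1) i (n-1)
-- as the remaining minor. Hence det T[i,j] = q^(i(0 + 1 + ⋯ + (j-i))). No division occurs.

open import Defs
open import Level using (Level)
open import Algebra.Bundles using (CommutativeRing)
open import Data.Nat using (ℕ; zero; suc; _≤_; _<_; _∸_; _≤?_; s≤s)
import Data.Nat as ℕ
import Data.Nat.Properties as ℕ
open import Data.Fin using (Fin; zero; suc; toℕ; punchIn; punchOut; inject₁; fromℕ<; inject≤; _≟_)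
import Data.Fin.Properties as Fin
open import Data.Product using (Σ-syntax; _×_; _,_)
open import Data.Sum using (_⊎_; inj₁; inj₂)
open import Data.Empty using (⊥-elim)
open import Function using (_∘_)
open import Relation.Nullary using (¬_; yes; no)
open import Relation.Binary.PropositionalEquality as ≡ using (_≡_; _≢_)
open import Data.Nat.Solver using (module +-*-Solver)
import Algebra.Properties.Ring as RingProperties
import Algebra.Properties.Semiring.Sum as SemiringSum
import Algebra.Properties.CommutativeSemiring.Exp as CommutativeSemiringExp
import Algebra.Properties.Group as GroupProperties
import Algebra.Solver.Ring.NaturalCoefficients.Default as NaturalCoefficients
import Relation.Binary.Reasoning.Setoid as SetoidReasoning

punchIn-adjacent : ∀ {n} (j : Fin (suc (suc n))) (c : Fin (suc n)) → j ≢ inject₁ c → j ≢ suc c →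
                   Σ[ c′ ∈ Fin n ] punchIn j (inject₁ c′) ≡ inject₁ c × punchIn j (suc c′) ≡ suc c
punchIn-adjacent zero zero j≢c _ = ⊥-elim (j≢c ≡.refl)
punchIn-adjacent zero (suc c) _ _ = c , ≡.refl , ≡.refl
punchIn-adjacent (suc zero) zero _ j≢c+1 = ⊥-elim (j≢c+1 ≡.refl)
punchIn-adjacent {suc n} (suc (suc j)) zero _ _ = zero , ≡.refl , ≡.refl
punchIn-adjacent {suc n} (suc j) (suc c) j≢c j≢c+1
  with c′ , eq₁ , eq₂ ← punchIn-adjacent j c (j≢c ∘ ≡.cong suc) (j≢c+1 ∘ ≡.cong suc)
  = suc c′ , ≡.cong suc eq₁ , ≡.cong suc eq₂

punchIn-inject₁-suc : ∀ {n} (c s : Fin (suc n)) →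
                      punchIn (inject₁ c) s ≡ punchIn (suc c) s
                      ⊎ punchIn (inject₁ c) s ≡ suc c × punchIn (suc c) s ≡ inject₁ c
punchIn-inject₁-suc zero zero = inj₂ (≡.refl , ≡.refl)
punchIn-inject₁-suc zero (suc s) = inj₁ ≡.refl
punchIn-inject₁-suc (suc c) zero = inj₁ ≡.refl
punchIn-inject₁-suc {suc n} (suc c) (suc s) with punchIn-inject₁-suc c s
... | inj₁ eq = inj₁ (≡.cong suc eq)
... | inj₂ (eq₁ , eq₂) = inj₂ (≡.cong suc eq₁ , ≡.cong suc eq₂)

inject₁≢suc : ∀ {n} (c : Fin n) → inject₁ c ≢ suc c
inject₁≢suc c eq = ℕ.1+n≢n (≡.trans (≡.cong toℕ (≡.sym eq)) (Fin.toℕ-inject₁ c))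

module Determinant {a ℓ} (R : CommutativeRing a ℓ) where
  open CommutativeRing R hiding (zero)
  open MatDefs R
  open RingProperties ring using (-‿distribˡ-*)
  open SemiringSum semiring using (sum; sum-cong-≋; sum-replicate-zero; ∑-distrib-+; *-distribˡ-sum)
  open NaturalCoefficients commutativeSemiring using (solve; _:=_; _:+_; _:*_)
  open SetoidReasoning setoid

  minor : ∀ {n} → Mat (suc n) → Fin (suc n) → Mat n
  minor M j r s = M (suc r) (punchIn j s)

  laplaceTerm : ∀ {n} → Mat (suc n) → Fin (suc n) → Carrier
  laplaceTerm {n} M j = sign (toℕ j) * (M zero j * det n (minor M j))

  sumFin≡sum : ∀ n (f : Fin n → Carrier) → sumFin n f ≡ sum f
  sumFin≡sum zero    f = ≡.refl
  sumFin≡sum (suc n) f = ≡.cong (f zero +_) (sumFin≡sum n (f ∘ suc))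

  det≡sum-laplaceTerm : ∀ {n} (M : Mat (suc n)) → det (suc n) M ≡ sum (laplaceTerm M)
  det≡sum-laplaceTerm {n} M = sumFin≡sum (suc n) (laplaceTerm M)

  sum-≈0 : ∀ {n} (f : Fin n → Carrier) → (∀ k → f k ≈ 0#) → sum f ≈ 0#
  sum-≈0 {n} f f≈0 = trans (sum-cong-≋ f≈0) (sum-replicate-zero n)

  sum-cancelling-adjacent : ∀ {n} (f : Fin (suc (suc n)) → Carrier) (c : Fin (suc n)) →
                            (∀ j → j ≢ inject₁ c → j ≢ suc c → f j ≈ 0#) →
                            f (inject₁ c) + f (suc c) ≈ 0# → sum f ≈ 0#
  sum-cancelling-adjacent {n} f zero others pair = begin
    f zero + (f (suc zero) + sum tail) ≈⟨ +-assoc _ _ _ ⟨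
    (f zero + f (suc zero)) + sum tail ≈⟨ +-cong pair (sum-≈0 tail λ k → others (suc (suc k)) (λ ()) (λ ())) ⟩
    0# + 0#                            ≈⟨ +-identityʳ 0# ⟩
    0#                                 ∎
    where
    tail : Fin n → Carrier
    tail k = f (suc (suc k))
  sum-cancelling-adjacent {suc n} f (suc c) others pair = begin
    f zero + sum (f ∘ suc) ≈⟨ +-cong (others zero (λ ()) (λ ())) (sum-cancelling-adjacent (f ∘ suc) c others′ pair) ⟩
    0# + 0#                ≈⟨ +-identityʳ 0# ⟩
    0#                     ∎
    where
    others′ : ∀ j → j ≢ inject₁ c → j ≢ suc c → f (suc j) ≈ 0#
    others′ j j≢c j≢c+1 = others (suc j) (j≢c ∘ Fin.suc-injective) (j≢c+1 ∘ Fin.suc-injective)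

  det-cong : ∀ {n} {M N : Mat n} → (∀ r s → M r s ≈ N r s) → det n M ≈ det n N
  det-cong {zero}  _ = refl
  det-cong {suc n} {M} {N} M≈N = begin
    det (suc n) M       ≡⟨ det≡sum-laplaceTerm M ⟩
    sum (laplaceTerm M) ≈⟨ sum-cong-≋ terms≈ ⟩
    sum (laplaceTerm N) ≡⟨ det≡sum-laplaceTerm N ⟨
    det (suc n) N       ∎
    where
    terms≈ : ∀ j → laplaceTerm M j ≈ laplaceTerm N j
    terms≈ j = *-congˡ (*-cong (M≈N zero j) (det-cong λ r s → M≈N (suc r) (punchIn j s)))

  det-first-row-tail≈0 : ∀ {n} (M : Mat (suc n)) → (∀ k → M zero (suc k) ≈ 0#) →
                       det (suc n) M ≈ M zero zero * det n (minor M zero)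
  det-first-row-tail≈0 {n} M first-row≈0 = begin
    det (suc n) M                                       ≡⟨⟩
    laplaceTerm M zero + sumFin n (laplaceTerm M ∘ suc) ≈⟨ +-cong (*-identityˡ _) rest≈0 ⟩
    M zero zero * det n (minor M zero) + 0#             ≈⟨ +-identityʳ _ ⟩
    M zero zero * det n (minor M zero)                  ∎
    where
    rest≈0 : sumFin n (laplaceTerm M ∘ suc) ≈ 0#
    rest≈0 = trans (reflexive (sumFin≡sum n _)) (sum-≈0 _ λ k →
      trans (*-congˡ (trans (*-congʳ (first-row≈0 k)) (zeroˡ _))) (zeroʳ _))

  det-linear-column : ∀ {n} (A B C : Mat n) (p : Fin n) (μ : Carrier) →
                      (∀ r s → s ≢ p → C r s ≈ A r s) → (∀ r s → s ≢ p → B r s ≈ A r s) →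
                      (∀ r → C r p ≈ A r p + μ * B r p) →
                      det n C ≈ det n A + μ * det n B
  det-linear-column {suc n} A B C p μ C≈A B≈A C-column = begin
    det (suc n) C                                         ≡⟨ det≡sum-laplaceTerm C ⟩
    sum (laplaceTerm C)                                   ≈⟨ sum-cong-≋ term-linear ⟩
    sum (λ j → laplaceTerm A j + μ * laplaceTerm B j)     ≈⟨ ∑-distrib-+ (laplaceTerm A) (λ j → μ * laplaceTerm B j) ⟩
    sum (laplaceTerm A) + sum (λ j → μ * laplaceTerm B j) ≈⟨ +-congˡ (*-distribˡ-sum μ (laplaceTerm B)) ⟨
    sum (laplaceTerm A) + μ * sum (laplaceTerm B)         ≡⟨ ≡.cong₂ (λ a b → a + μ * b)
                                                               (det≡sum-laplaceTerm A) (det≡sum-laplaceTerm B) ⟨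
    det (suc n) A + μ * det (suc n) B                     ∎
    where
    term-linear : ∀ j → laplaceTerm C j ≈ laplaceTerm A j + μ * laplaceTerm B j
    term-linear j with j ≟ p
    ... | yes ≡.refl = begin
      sign (toℕ j) * (C zero j * det n (minor C j))
        ≈⟨ *-congˡ (*-cong (C-column zero) (det-cong λ r s → C≈A (suc r) (punchIn j s) (Fin.punchInᵢ≢i j s))) ⟩
      sign (toℕ j) * ((A zero j + μ * B zero j) * det n (minor A j))
        ≈⟨ solve 5 (λ σ a m b d → σ :* ((a :+ m :* b) :* d) := σ :* (a :* d) :+ m :* (σ :* (b :* d)))
                 refl (sign (toℕ j)) (A zero j) μ (B zero j) (det n (minor A j)) ⟩
      laplaceTerm A j + μ * (sign (toℕ j) * (B zero j * det n (minor A j)))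
        ≈⟨ +-congˡ (*-congˡ (*-congˡ (*-congˡ (det-cong λ r s → B≈A (suc r) (punchIn j s) (Fin.punchInᵢ≢i j s))))) ⟨
      laplaceTerm A j + μ * laplaceTerm B j
        ∎
    ... | no j≢p = begin
      sign (toℕ j) * (C zero j * det n (minor C j))
        ≈⟨ *-congˡ (*-cong (C≈A zero j j≢p) minor-linear) ⟩
      sign (toℕ j) * (A zero j * (det n (minor A j) + μ * det n (minor B j)))
        ≈⟨ solve 5 (λ σ a m d e → σ :* (a :* (d :+ m :* e)) := σ :* (a :* d) :+ m :* (σ :* (a :* e)))
                 refl (sign (toℕ j)) (A zero j) μ (det n (minor A j)) (det n (minor B j)) ⟩
      laplaceTerm A j + μ * (sign (toℕ j) * (A zero j * det n (minor B j)))
        ≈⟨ +-congˡ (*-congˡ (*-congˡ (*-congʳ (B≈A zero j j≢p)))) ⟨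
      laplaceTerm A j + μ * laplaceTerm B j
        ∎
      where
      p′ : Fin n
      p′ = punchOut j≢p
      avoids-p : ∀ s → s ≢ p′ → punchIn j s ≢ p
      avoids-p s s≢p′ eq = s≢p′ (Fin.punchIn-injective j s p′ (≡.trans eq (≡.sym (Fin.punchIn-punchOut j≢p))))
      minor-linear : det n (minor C j) ≈ det n (minor A j) + μ * det n (minor B j)
      minor-linear = det-linear-column (minor A j) (minor B j) (minor C j) p′ μ
        (λ r s s≢p′ → C≈A (suc r) (punchIn j s) (avoids-p s s≢p′))
        (λ r s s≢p′ → B≈A (suc r) (punchIn j s) (avoids-p s s≢p′))
        (λ r → ≡.subst (λ t → C (suc r) t ≈ A (suc r) t + μ * B (suc r) t)
                       (≡.sym (Fin.punchIn-punchOut j≢p)) (C-column (suc r)))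

  det-equal-adjacent-columns : ∀ {n} (M : Mat (suc n)) (c : Fin n) →
                               (∀ r → M r (inject₁ c) ≈ M r (suc c)) → det (suc n) M ≈ 0#
  det-equal-adjacent-columns {suc n} M c columns≈ = begin
    det (suc (suc n)) M ≡⟨ det≡sum-laplaceTerm M ⟩
    sum (laplaceTerm M) ≈⟨ sum-cancelling-adjacent (laplaceTerm M) c other-terms≈0 pair-cancels ⟩
    0#                  ∎
    where
    other-terms≈0 : ∀ j → j ≢ inject₁ c → j ≢ suc c → laplaceTerm M j ≈ 0#
    other-terms≈0 j j≢c j≢c+1 with c′ , eq₁ , eq₂ ← punchIn-adjacent j c j≢c j≢c+1 =
      trans (*-congˡ (trans (*-congˡ minor≈0) (zeroʳ _))) (zeroʳ _)
      where
      minor≈0 : det (suc n) (minor M j) ≈ 0#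
      minor≈0 = det-equal-adjacent-columns (minor M j) c′ λ r →
        ≡.subst₂ (λ x y → M (suc r) x ≈ M (suc r) y) (≡.sym eq₁) (≡.sym eq₂) (columns≈ (suc r))
    same-minor : ∀ r s → minor M (inject₁ c) r s ≈ minor M (suc c) r s
    same-minor r s with punchIn-inject₁-suc c s
    ... | inj₁ eq = reflexive (≡.cong (M (suc r)) eq)
    ... | inj₂ (eq₁ , eq₂) = begin
      M (suc r) (punchIn (inject₁ c) s) ≡⟨ ≡.cong (M (suc r)) eq₁ ⟩
      M (suc r) (suc c)                 ≈⟨ columns≈ (suc r) ⟨
      M (suc r) (inject₁ c)             ≡⟨ ≡.cong (M (suc r)) eq₂ ⟨
      M (suc r) (punchIn (suc c) s)     ∎
    X : Carrier
    X = M zero (suc c) * det (suc n) (minor M (suc c))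
    pair-cancels : laplaceTerm M (inject₁ c) + laplaceTerm M (suc c) ≈ 0#
    pair-cancels = begin
      sign (toℕ (inject₁ c)) * (M zero (inject₁ c) * det (suc n) (minor M (inject₁ c))) + - sign (toℕ c) * X
        ≈⟨ +-congʳ (*-cong (reflexive (≡.cong sign (Fin.toℕ-inject₁ c))) (*-cong (columns≈ zero) (det-cong same-minor))) ⟩
      sign (toℕ c) * X + - sign (toℕ c) * X
        ≈⟨ +-congˡ (-‿distribˡ-* _ _) ⟨
      sign (toℕ c) * X + - (sign (toℕ c) * X)
        ≈⟨ -‿inverseʳ _ ⟩
      0# ∎

  replaceColumn : ∀ {n} → Mat n → Fin n → (Fin n → Carrier) → Mat n
  replaceColumn M p v r s with s ≟ p
  ... | yes _ = v r
  ... | no  _ = M r s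

  replaceColumn-≢ : ∀ {n} (M : Mat n) p v r {s} → s ≢ p → replaceColumn M p v r s ≡ M r s
  replaceColumn-≢ M p v r {s} s≢p with s ≟ p
  ... | yes s≡p = ⊥-elim (s≢p s≡p)
  ... | no  _   = ≡.refl

  replaceColumn-≡ : ∀ {n} (M : Mat n) p v r → replaceColumn M p v r p ≡ v r
  replaceColumn-≡ M p v r with p ≟ p
  ... | yes _   = ≡.refl
  ... | no  p≢p = ⊥-elim (p≢p ≡.refl)

  det-subtract-previous-column : ∀ {n} (M C : Mat (suc n)) (c : Fin n) (μ : Carrier) →
                                 (∀ r s → s ≢ suc c → C r s ≈ M r s) →
                                 (∀ r → C r (suc c) ≈ M r (suc c) - μ * M r (inject₁ c)) →
                                 det (suc n) C ≈ det (suc n) M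
  det-subtract-previous-column {n} M C c μ C≈M C-column = begin
    det (suc n) C                       ≈⟨ det-linear-column M B C (suc c) (- μ) C≈M B≈M C-column′ ⟩
    det (suc n) M + - μ * det (suc n) B ≈⟨ +-congˡ (trans (*-congˡ det-B≈0) (zeroʳ _)) ⟩
    det (suc n) M + 0#                  ≈⟨ +-identityʳ _ ⟩
    det (suc n) M                       ∎
    where
    B : Mat (suc n)
    B = replaceColumn M (suc c) (λ r → M r (inject₁ c))
    B≈M : ∀ r s → s ≢ suc c → B r s ≈ M r s
    B≈M r s s≢c+1 = reflexive (replaceColumn-≢ M (suc c) _ r s≢c+1)
    C-column′ : ∀ r → C r (suc c) ≈ M r (suc c) + - μ * B r (suc c)
    C-column′ r = trans (C-column r)
      (+-congˡ (trans (-‿distribˡ-* μ _) (*-congˡ (reflexive (≡.sym (replaceColumn-≡ M (suc c) _ r))))))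
    det-B≈0 : det (suc n) B ≈ 0#
    det-B≈0 = det-equal-adjacent-columns B c λ r → begin
      B r (inject₁ c) ≈⟨ B≈M r (inject₁ c) (inject₁≢suc c) ⟩
      M r (inject₁ c) ≡⟨ replaceColumn-≡ M (suc c) _ r ⟨
      B r (suc c)     ∎

  -- All differences use the original columns: this is the effect of the column operations
  -- performed from right to left, each of which keeps the determinant.
  columnDifferencesFrom : ∀ {n} → Carrier → ℕ → Mat (suc n) → Mat (suc n)
  columnDifferencesFrom μ k M r zero = M r zero
  columnDifferencesFrom μ k M r (suc s) with k ≤? toℕ s
  ... | yes _ = M r (suc s) - μ * M r (inject₁ s)
  ... | no  _ = M r (suc s)

  columnDifferencesFrom-below : ∀ {n} μ k (M : Mat (suc n)) r t → toℕ t ≤ k →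
                                columnDifferencesFrom μ k M r t ≡ M r t
  columnDifferencesFrom-below μ k M r zero    _ = ≡.refl
  columnDifferencesFrom-below μ k M r (suc s) s<k with k ≤? toℕ s
  ... | yes k≤s = ⊥-elim (ℕ.<⇒≱ s<k k≤s)
  ... | no  _   = ≡.refl

  det-columnDifferencesFrom-suc : ∀ {n} μ k (M : Mat (suc n)) → k < n →
                                  det (suc n) (columnDifferencesFrom μ k M) ≈ det (suc n) (columnDifferencesFrom μ (suc k) M)
  det-columnDifferencesFrom-suc {n} μ k M k<n =
    det-subtract-previous-column (columnDifferencesFrom μ (suc k) M) (columnDifferencesFrom μ k M) c μ other-columns column-c+1
    where
    c : Fin n
    c = fromℕ< k<n
    c≡k : toℕ c ≡ k
    c≡k = Fin.toℕ-fromℕ< k<n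
    other-columns : ∀ r s → s ≢ suc c → columnDifferencesFrom μ k M r s ≈ columnDifferencesFrom μ (suc k) M r s
    other-columns r zero    _ = refl
    other-columns r (suc s) s≢c with k ≤? toℕ s | suc k ≤? toℕ s
    ... | yes _   | yes _   = refl
    ... | no  _   | no  _   = refl
    ... | no  k≰s | yes k<s = ⊥-elim (k≰s (ℕ.<⇒≤ k<s))
    ... | yes k≤s | no  k≮s = ⊥-elim (s≢c (≡.cong suc (Fin.toℕ-injective
                                (≡.trans (ℕ.≤-antisym (ℕ.≮⇒≥ k≮s) k≤s) (≡.sym c≡k)))))
    column-c+1 : ∀ r → columnDifferencesFrom μ k M r (suc c)
                       ≈ columnDifferencesFrom μ (suc k) M r (suc c) - μ * columnDifferencesFrom μ (suc k) M r (inject₁ c)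
    column-c+1 r with k ≤? toℕ c | suc k ≤? toℕ c
    ... | no  k≰c | _       = ⊥-elim (k≰c (ℕ.≤-reflexive (≡.sym c≡k)))
    ... | yes _   | yes k<c = ⊥-elim (ℕ.<-irrefl (≡.sym c≡k) k<c)
    ... | yes _   | no  _   = reflexive (≡.cong (λ x → M r (suc c) - μ * x)
      (≡.sym (columnDifferencesFrom-below μ (suc k) M r (inject₁ c)
        (ℕ.≤-trans (ℕ.≤-reflexive (≡.trans (Fin.toℕ-inject₁ c) c≡k)) (ℕ.n≤1+n k)))))

  det-columnDifferences : ∀ {n} μ (M : Mat (suc n)) → det (suc n) (columnDifferencesFrom μ 0 M) ≈ det (suc n) M
  det-columnDifferences {n} μ M = from n (ℕ.+-identityʳ n)
    where
    from : ∀ t {k} → t ℕ.+ k ≡ n → det (suc n) (columnDifferencesFrom μ k M) ≈ det (suc n) M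
    from zero {k} k≡n = det-cong λ r s →
      reflexive (columnDifferencesFrom-below μ k M r s (≡.subst (toℕ s ≤_) (≡.sym k≡n) (Fin.toℕ≤pred[n] s)))
    from (suc t) {k} t+1+k≡n = trans
      (det-columnDifferencesFrom-suc μ k M (≡.subst (k <_) t+1+k≡n (s≤s (ℕ.m≤n+m k t))))
      (from t (≡.trans (ℕ.+-suc t k) t+1+k≡n))

module TriangularNumbers where
  open import Data.Nat using (_+_; _*_)
  open import Data.Nat.DivMod using (_/_; m*n/n≡m)
  open +-*-Solver

  triangular : ℕ → ℕ
  triangular zero    = 0
  triangular (suc n) = suc n + triangular n

  n*[n+1]≡triangular[n]*2 : ∀ n → n * (n + 1) ≡ triangular n * 2
  n*[n+1]≡triangular[n]*2 zero    = ≡.refl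
  n*[n+1]≡triangular[n]*2 (suc n) = begin
    suc n * (suc n + 1)            ≡⟨ solve 1 (λ n → (con 1 :+ n) :* ((con 1 :+ n) :+ con 1)
                                                := (con 1 :+ n) :* con 2 :+ n :* (n :+ con 1)) ≡.refl n ⟩
    suc n * 2 + n * (n + 1)        ≡⟨ ≡.cong (suc n * 2 +_) (n*[n+1]≡triangular[n]*2 n) ⟩
    suc n * 2 + triangular n * 2   ≡⟨ ℕ.*-distribʳ-+ 2 (suc n) (triangular n) ⟨
    triangular (suc n) * 2         ∎
    where open ≡.≡-Reasoning

  i*n*[n+1]/2≡i*triangular[n] : ∀ i n → (i * n * (n + 1)) / 2 ≡ i * triangular n
  i*n*[n+1]/2≡i*triangular[n] i n = begin
    (i * n * (n + 1)) / 2     ≡⟨ ≡.cong (_/ 2) (ℕ.*-assoc i n (n + 1)) ⟩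
    (i * (n * (n + 1))) / 2   ≡⟨ ≡.cong (λ x → (i * x) / 2) (n*[n+1]≡triangular[n]*2 n) ⟩
    (i * (triangular n * 2)) / 2 ≡⟨ ≡.cong (_/ 2) (ℕ.*-assoc i (triangular n) 2) ⟨
    (i * triangular n * 2) / 2 ≡⟨ m*n/n≡m (i * triangular n) 2 ⟩
    i * triangular n          ∎
    where open ≡.≡-Reasoning

  -- c (n + 1) + triangular n = c + (c + 1) + ⋯ + (c + n)
  weighted-exponent-zero : ∀ c i → c * i ≡ i * (c * 1 + triangular 0)
  weighted-exponent-zero = solve 2 (λ c i → c :* i := i :* (c :* con 1 :+ con 0)) ≡.refl

  weighted-exponent-suc : ∀ c i n → c * i + i * (suc c * suc n + triangular n) ≡ i * (c * suc (suc n) + triangular (suc n))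
  weighted-exponent-suc c i n = solve 4 (λ c i n t → c :* i :+ i :* ((con 1 :+ c) :* (con 1 :+ n) :+ t)
                                      := i :* (c :* (con 2 :+ n) :+ ((con 1 :+ n) :+ t))) ≡.refl c i n (triangular n)

open TriangularNumbers using (triangular; i*n*[n+1]/2≡i*triangular[n]; weighted-exponent-zero; weighted-exponent-suc)

module GaussianBinomial {a ℓ} (R : CommutativeRing a ℓ) (q : CommutativeRing.Carrier R) where
  open CommutativeRing R hiding (zero)
  open MatDefs R
  open CommutativeSemiringExp commutativeSemiring using (_^_)
  open NaturalCoefficients commutativeSemiring using (solve; _:=_; _:+_; _:*_; con)
  open SetoidReasoning setoid

  pow≡^ : ∀ x n → pow x n ≡ x ^ n
  pow≡^ x zero    = ≡.refl
  pow≡^ x (suc n) = ≡.cong (x *_) (pow≡^ x n)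

  qbinom-zeroʳ : ∀ m → qbinom q m 0 ≡ 1#
  qbinom-zeroʳ zero    = ≡.refl
  qbinom-zeroʳ (suc m) = ≡.refl

  qbinom≈0 : ∀ {m k} → m < k → qbinom q m k ≈ 0#
  qbinom≈0 {zero}  {suc k} _         = refl
  qbinom≈0 {suc m} {suc k} (s≤s m<k) = begin
    qbinom q m k + pow q (suc k) * qbinom q m (suc k) ≈⟨ +-cong (qbinom≈0 m<k) (*-congˡ (qbinom≈0 (ℕ.m<n⇒m<1+n m<k))) ⟩
    0# + pow q (suc k) * 0#                           ≈⟨ trans (+-identityˡ _) (zeroʳ _) ⟩
    0#                                                ∎

  -- The truncated subtraction is harmless: if m ≤ r then the binomial vanishes.
  power-shift-qbinom : ∀ x m r → x * (x ^ (m ∸ suc r) * qbinom q m (suc r)) ≈ x ^ (m ∸ r) * qbinom q m (suc r)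
  power-shift-qbinom x m r with suc r ≤? m
  ... | yes r<m = begin
    x * (x ^ (m ∸ suc r) * qbinom q m (suc r)) ≈⟨ *-assoc _ _ _ ⟨
    x ^ suc (m ∸ suc r) * qbinom q m (suc r)   ≡⟨ ≡.cong (λ e → x ^ e * qbinom q m (suc r)) (ℕ.+-∸-assoc 1 r<m) ⟨
    x ^ (m ∸ r) * qbinom q m (suc r)           ∎
  ... | no  r≮m = begin
    x * (x ^ (m ∸ suc r) * qbinom q m (suc r)) ≈⟨ *-congˡ (*-congˡ vanishes) ⟩
    x * (x ^ (m ∸ suc r) * 0#)                 ≈⟨ trans (*-congˡ (zeroʳ _)) (zeroʳ _) ⟩
    0#                                         ≈⟨ trans (*-congˡ vanishes) (zeroʳ _) ⟨
    x ^ (m ∸ r) * qbinom q m (suc r)           ∎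
    where
    vanishes : qbinom q m (suc r) ≈ 0#
    vanishes = qbinom≈0 (ℕ.≰⇒> r≮m)

  qbinom-pascal-dual : ∀ m r → qbinom q (suc m) (suc r) ≈ q ^ (m ∸ r) * qbinom q m r + qbinom q m (suc r)
  qbinom-pascal-dual zero    zero    = +-cong (sym (*-identityˡ _)) (zeroʳ _)
  qbinom-pascal-dual zero    (suc r) = +-cong (sym (*-identityˡ _)) (zeroʳ _)
  qbinom-pascal-dual (suc m) zero    = begin
    1# + q ^ 1 * qbinom q (suc m) 1
      ≈⟨ +-congˡ (*-congˡ (qbinom-pascal-dual m 0)) ⟩
    1# + q ^ 1 * (q ^ m * qbinom q m 0 + qbinom q m 1)
      ≡⟨ ≡.cong (λ b → 1# + q ^ 1 * (q ^ m * b + qbinom q m 1)) (qbinom-zeroʳ m) ⟩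
    1# + q ^ 1 * (q ^ m * 1# + qbinom q m 1)
      ≈⟨ solve 3 (λ q Q b → con 1 :+ q :* con 1 :* (Q :* con 1 :+ b) := q :* Q :* con 1 :+ (con 1 :+ q :* con 1 :* b))
               refl q (q ^ m) (qbinom q m 1) ⟩
    q ^ suc m * 1# + (1# + q ^ 1 * qbinom q m 1)
      ≡⟨ ≡.cong (λ b → q ^ suc m * 1# + (b + q ^ 1 * qbinom q m 1)) (qbinom-zeroʳ m) ⟨
    q ^ suc m * 1# + qbinom q (suc m) 1
      ∎
  qbinom-pascal-dual (suc m) (suc r) = begin
    qbinom q (suc m) (suc r) + pow q (suc (suc r)) * qbinom q (suc m) (suc (suc r))
      ≈⟨ +-cong (qbinom-pascal-dual m r) (*-cong (reflexive (pow≡^ q (suc (suc r)))) (qbinom-pascal-dual m (suc r))) ⟩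
    (q ^ e * A + B) + q * P * (q ^ (m ∸ suc r) * B + C)
      ≈⟨ solve 7 (λ E A B q P K C → (E :* A :+ B) :+ q :* P :* (K :* B :+ C) := E :* A :+ B :+ P :* (q :* (K :* B)) :+ q :* P :* C)
               refl (q ^ e) A B q P (q ^ (m ∸ suc r)) C ⟩
    q ^ e * A + B + P * (q * (q ^ (m ∸ suc r) * B)) + q * P * C
      ≈⟨ +-congʳ (+-congˡ (*-congˡ (power-shift-qbinom q m r))) ⟩
    q ^ e * A + B + P * (q ^ e * B) + q * P * C
      ≈⟨ solve 6 (λ E A B P q C → E :* A :+ B :+ P :* (E :* B) :+ q :* P :* C := E :* (A :+ P :* B) :+ (B :+ q :* P :* C))
               refl (q ^ e) A B P q C ⟩
    q ^ e * (A + P * B) + (B + q * P * C)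
      ≡⟨ ≡.cong₂ (λ x y → q ^ e * (A + x * B) + (B + y * C)) (pow≡^ q (suc r)) (pow≡^ q (suc (suc r))) ⟨
    q ^ e * qbinom q (suc m) (suc r) + qbinom q (suc m) (suc (suc r))
      ∎
    where
    e = m ∸ r
    A = qbinom q m r
    B = qbinom q m (suc r)
    C = qbinom q m (suc (suc r))
    P = q ^ suc r

module WeightedBinomialMatrix {a ℓ} (R : CommutativeRing a ℓ) (q : CommutativeRing.Carrier R) where
  open CommutativeRing R hiding (zero)
  open MatDefs R
  open Determinant R
  open GaussianBinomial R q
  open CommutativeSemiringExp commutativeSemiring using (_^_; ^-homo-*; ^-assocʳ)
  open GroupProperties +-group using (//-rightDividesʳ; x≈y⇒x∙y⁻¹≈ε)
  open SetoidReasoning setoid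

  weightedEntry : ℕ → ℕ → ℕ → Carrier
  weightedEntry c m r = q ^ (c ℕ.* (m ∸ r)) * qbinom q m r

  weighted : ℕ → ℕ → ∀ n → Mat (suc n)
  weighted c i n r s = weightedEntry c (i ℕ.+ toℕ s) (toℕ r)

  weightedEntry-zero : ∀ c m → weightedEntry c m 0 ≈ q ^ (c ℕ.* m)
  weightedEntry-zero c m = trans (reflexive (≡.cong (q ^ (c ℕ.* m) *_) (qbinom-zeroʳ m))) (*-identityʳ _)

  weightedEntry-difference-zero : ∀ c m → weightedEntry c (suc m) 0 - q ^ c * weightedEntry c m 0 ≈ 0#
  weightedEntry-difference-zero c m = x≈y⇒x∙y⁻¹≈ε (begin
    weightedEntry c (suc m) 0          ≈⟨ weightedEntry-zero c (suc m) ⟩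
    q ^ (c ℕ.* suc m)                  ≡⟨ ≡.cong (q ^_) (ℕ.*-suc c m) ⟩
    q ^ (c ℕ.+ c ℕ.* m)                ≈⟨ ^-homo-* q c (c ℕ.* m) ⟩
    q ^ c * q ^ (c ℕ.* m)              ≈⟨ *-congˡ (weightedEntry-zero c m) ⟨
    q ^ c * weightedEntry c m 0        ∎)

  weightedEntry-difference-suc : ∀ c m r →
    weightedEntry c (suc m) (suc r) - q ^ c * weightedEntry c m (suc r) ≈ weightedEntry (suc c) m r
  weightedEntry-difference-suc c m r = begin
    q ^ (c ℕ.* e) * qbinom q (suc m) (suc r) - q ^ c * (q ^ (c ℕ.* (m ∸ suc r)) * B)
      ≈⟨ +-cong (*-congˡ (qbinom-pascal-dual m r)) (-‿cong shifted) ⟩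
    q ^ (c ℕ.* e) * (q ^ e * A + B) - q ^ (c ℕ.* e) * B
      ≈⟨ +-congʳ (distribˡ _ _ _) ⟩
    (q ^ (c ℕ.* e) * (q ^ e * A) + q ^ (c ℕ.* e) * B) - q ^ (c ℕ.* e) * B
      ≈⟨ //-rightDividesʳ _ _ ⟩
    q ^ (c ℕ.* e) * (q ^ e * A)
      ≈⟨ *-assoc _ _ _ ⟨
    q ^ (c ℕ.* e) * q ^ e * A
      ≈⟨ *-congʳ (trans (^-homo-* q e (c ℕ.* e)) (*-comm _ _)) ⟨
    q ^ (suc c ℕ.* e) * A
      ∎
    where
    e = m ∸ r
    A = qbinom q m r
    B = qbinom q m (suc r)
    shifted : q ^ c * (q ^ (c ℕ.* (m ∸ suc r)) * B) ≈ q ^ (c ℕ.* e) * B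
    shifted = begin
      q ^ c * (q ^ (c ℕ.* (m ∸ suc r)) * B) ≈⟨ *-congˡ (*-congʳ (^-assocʳ q c (m ∸ suc r))) ⟨
      q ^ c * ((q ^ c) ^ (m ∸ suc r) * B)   ≈⟨ power-shift-qbinom (q ^ c) m r ⟩
      (q ^ c) ^ e * B                       ≈⟨ *-congʳ (^-assocʳ q c e) ⟩
      q ^ (c ℕ.* e) * B                     ∎

  det-weighted-suc : ∀ c i n → det (suc (suc n)) (weighted c i (suc n))
                                ≈ q ^ (c ℕ.* i) * det (suc n) (weighted (suc c) i n)
  det-weighted-suc c i n = begin
    det (suc (suc n)) K                                ≈⟨ det-columnDifferences (q ^ c) K ⟨
    det (suc (suc n)) D                                ≈⟨ det-first-row-tail≈0 D first-row-tail≈0 ⟩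
    D zero zero * det (suc n) (minor D zero)           ≈⟨ *-cong head (det-cong minor≈weighted) ⟩
    q ^ (c ℕ.* i) * det (suc n) (weighted (suc c) i n) ∎
    where
    K = weighted c i (suc n)
    D = columnDifferencesFrom (q ^ c) 0 K
    shift : ∀ r s → D r (suc s) ≡ weightedEntry c (suc (i ℕ.+ toℕ s)) (toℕ r) - q ^ c * weightedEntry c (i ℕ.+ toℕ s) (toℕ r)
    shift r s = ≡.cong₂ (λ m m′ → weightedEntry c m (toℕ r) - q ^ c * weightedEntry c m′ (toℕ r))
                        (ℕ.+-suc i (toℕ s)) (≡.cong (i ℕ.+_) (Fin.toℕ-inject₁ s))
    head : D zero zero ≈ q ^ (c ℕ.* i)
    head = trans (weightedEntry-zero c (i ℕ.+ 0)) (reflexive (≡.cong (λ m → q ^ (c ℕ.* m)) (ℕ.+-identityʳ i)))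
    first-row-tail≈0 : ∀ s → D zero (suc s) ≈ 0#
    first-row-tail≈0 s = trans (reflexive (shift zero s)) (weightedEntry-difference-zero c (i ℕ.+ toℕ s))
    minor≈weighted : ∀ r s → minor D zero r s ≈ weighted (suc c) i n r s
    minor≈weighted r s = trans (reflexive (shift (suc r) s)) (weightedEntry-difference-suc c (i ℕ.+ toℕ s) (toℕ r))

  det-weighted : ∀ c i n → det (suc n) (weighted c i n) ≈ q ^ (i ℕ.* (c ℕ.* suc n ℕ.+ triangular n))
  det-weighted c i zero = begin
    det 1 (weighted c i 0)           ≈⟨ det-first-row-tail≈0 (weighted c i 0) (λ ()) ⟩
    weightedEntry c (i ℕ.+ 0) 0 * 1# ≈⟨ trans (*-identityʳ _) (weightedEntry-zero c (i ℕ.+ 0)) ⟩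
    q ^ (c ℕ.* (i ℕ.+ 0))            ≡⟨ ≡.cong (λ m → q ^ (c ℕ.* m)) (ℕ.+-identityʳ i) ⟩
    q ^ (c ℕ.* i)                    ≡⟨ ≡.cong (q ^_) (weighted-exponent-zero c i) ⟩
    q ^ (i ℕ.* (c ℕ.* 1 ℕ.+ 0))      ∎
  det-weighted c i (suc n) = begin
    det (suc (suc n)) (weighted c i (suc n))                ≈⟨ det-weighted-suc c i n ⟩
    q ^ (c ℕ.* i) * det (suc n) (weighted (suc c) i n)      ≈⟨ *-congˡ (det-weighted (suc c) i n) ⟩
    q ^ (c ℕ.* i) * q ^ (i ℕ.* e)                           ≈⟨ ^-homo-* q (c ℕ.* i) (i ℕ.* e) ⟨
    q ^ (c ℕ.* i ℕ.+ i ℕ.* e)                               ≡⟨ ≡.cong (q ^_) (weighted-exponent-suc c i n) ⟩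
    q ^ (i ℕ.* (c ℕ.* suc (suc n) ℕ.+ triangular (suc n))) ∎
    where
    e = suc c ℕ.* suc n ℕ.+ triangular n

  Tmat-entry : ∀ d (a b : Fin (suc d)) → Tmat d q a b ≈ qbinom q (toℕ b) (toℕ a)
  Tmat-entry d a b with toℕ a ≤? toℕ b
  ... | yes _   = refl
  ... | no  a≰b = sym (qbinom≈0 (ℕ.≰⇒> a≰b))

  det-sub-Tmat : ∀ d i j (i≤j : i ≤ j) (j≤d : j ≤ d) →
                 det (suc (j ∸ i)) (sub d (Tmat d q) i j i≤j j≤d) ≈ pow q (i ℕ.* triangular (j ∸ i))
  det-sub-Tmat d i j i≤j j≤d = begin
    det (suc (j ∸ i)) (sub d (Tmat d q) i j i≤j j≤d) ≈⟨ det-cong sub≈weighted ⟩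
    det (suc (j ∸ i)) (weighted 0 i (j ∸ i))          ≈⟨ det-weighted 0 i (j ∸ i) ⟩
    q ^ (i ℕ.* triangular (j ∸ i))                    ≡⟨ pow≡^ q (i ℕ.* triangular (j ∸ i)) ⟨
    pow q (i ℕ.* triangular (j ∸ i))                  ∎
    where
    sub≈weighted : ∀ r s → sub d (Tmat d q) i j i≤j j≤d r s ≈ weighted 0 i (j ∸ i) r s
    sub≈weighted r s = begin
      sub d (Tmat d q) i j i≤j j≤d r s ≈⟨ Tmat-entry d (inject≤ r _) (fromℕ< {i ℕ.+ toℕ s} _) ⟩
      qbinom q (toℕ (fromℕ< {i ℕ.+ toℕ s} {suc d} _)) (toℕ (inject≤ {n = suc d} r _))
        ≡⟨ ≡.cong₂ (qbinom q) (Fin.toℕ-fromℕ< {m = i ℕ.+ toℕ s} _) (Fin.toℕ-inject≤ r _) ⟩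
      qbinom q (i ℕ.+ toℕ s) (toℕ r) ≈⟨ *-identityˡ _ ⟨
      weighted 0 i (j ∸ i) r s ∎

open import Data.Nat using (_+_; _*_)
open import Data.Nat.DivMod using (_/_)

proposition9p6 : ∀ {c ℓ : Level} (F : Field c ℓ) (d : ℕ) → 2 ≤ d →
    (q : Field.Carrier F) → ¬ (Field._≈_ F q (Field.0# F)) →
    (i j : ℕ) (i≤j : i ≤ j) (j≤d : j ≤ d) →
    let open MatDefs (Field.commutativeRing F) in
    Field._≈_ F (det (suc (j ∸ i)) (sub d (Tmat d q) i j i≤j j≤d))
      (pow q ((i * (j ∸ i) * (j ∸ i + 1)) / 2))
proposition9p6 F d _ q _ i j i≤j j≤d = begin
  det (suc (j ∸ i)) (sub d (Tmat d q) i j i≤j j≤d) ≈⟨ det-sub-Tmat d i j i≤j j≤d ⟩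
  pow q (i * triangular (j ∸ i))                     ≡⟨ ≡.cong (pow q) (i*n*[n+1]/2≡i*triangular[n] i (j ∸ i)) ⟨
  pow q ((i * (j ∸ i) * (j ∸ i + 1)) / 2)            ∎
  where
  open Field F using (commutativeRing; setoid)
  open MatDefs commutativeRing
  open WeightedBinomialMatrix commutativeRing q
  open SetoidReasoning setoid
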